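{- Every quadtree configuration $T$ satisfying the following invariant is compact: for every $i\in\mathbb{N}_0$ and every empty $i$-pixel $p$ of $T$, there is no occupied $i$-pixel $q$ with $z(q) > z(p)$.
   Context: The unit square $[0,1]^2$ is recursively subdivided as a quadtree of unbounded depth: the root (layer $0$) is $[0,1]^2$, and every node (pixel) of layer $j$ is an axis-parallel square of side $2^{ -j}$ whose four children are its four quadrants. A pixel of layer $j$ is a $j$-pixel. For $r\in\mathbb{N}_0$, an $r$-square is an axis-parallel square of side $2^{ -r}$. A (quadtree) configuration assigns finitely many squares to pixels, each $j$-square to a $j$-pixel, at most one square per pixel, such that no pixel with an assigned square is a proper descendant of another pixel with an assigned square. A pixel contains a square if it is assigned to it or to a descendant. A pixel with an assigned square is occupied; a non-occupied pixel is blocked if some ancestor is occupied, free otherwise; a free pixel is fractional if it contains a square and empty if it contains no square; an empty pixel is maximally empty if its parent is not empty (an empty root counts as maximally empty). A fractional pixel is open if at least one of its children is (maximally) empty. A configuration is compact if for every $j\in\mathbb{N}_0$ there is at most one open $j$-pixel. Z-order: the four children of every pixel are given the fixed z-curve (Morton) order (top-left, top-right, bottom-left, bottom-right); for two pixels $p,q$ neither of which is a descendant of the other, $z(p)<z(q)$ iff, at their lowest common ancestor, the child containing $p$ precedes the child containing $q$ in this order. -}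

module Defs where

open import Data.Nat using (ℕ)
open import Data.Fin using (Fin) renaming (_<_ to _<ᶠ_)
open import Data.List using (List; []; _∷_; _++_; [_]; length)
open import Data.List.Membership.Propositional using (_∈_)
open import Data.List.Relation.Unary.Unique.Propositional using (Unique)
open import Data.Sum using (_⊎_)
open import Data.Product using (Σ; ∃; _×_; _,_)
open import Relation.Nullary using (¬_)
open import Relation.Binary.PropositionalEquality using (_≡_)

-- Quadrants of a pixel, in z-curve (Morton) order:
-- 0 = top-left, 1 = top-right, 2 = bottom-left, 3 = bottom-right.
Quadrant : Set
Quadrant = Fin 4

-- A pixel of the quadtree is the path of quadrant choices from the root.
-- The root is [] and a pixel of layer j is a path of length j
-- (geometrically a square of side 2^-j).
Pixel : Set
Pixel = List Quadrant

layer : Pixel → ℕ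
layer = length

child : Pixel → Quadrant → Pixel
child p c = p ++ [ c ]

_⊑_ : Pixel → Pixel → Set
p ⊑ q = ∃ λ s → p ++ s ≡ q

_⊏_ : Pixel → Pixel → Set
p ⊏ q = Σ Quadrant λ c → Σ Pixel λ s → p ++ (c ∷ s) ≡ q

-- Each j-square is assigned to a j-pixel, at most
-- one square per pixel, so a configuration is determined (for all notions
-- below) by its finite set of occupied pixels, listed without repetition;
-- the side length of the square assigned to pixel p is 2^-(layer p).
record Config : Set where
  field
    occupied  : List Pixel
    unique    : Unique occupied
    antichain : ∀ {p q} → p ∈ occupied → q ∈ occupied → ¬ (p ⊏ q)

module _ (T : Config) where
  open Config T

  Occupied : Pixel → Set
  Occupied p = p ∈ occupied

  Contains : Pixel → Set
  Contains p = Σ Pixel λ q → q ∈ occupied × p ⊑ q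

  Blocked : Pixel → Set
  Blocked p = ¬ Occupied p × (Σ Pixel λ a → a ∈ occupied × a ⊏ p)

  Free : Pixel → Set
  Free p = ¬ Occupied p × ¬ Blocked p

  Fractional : Pixel → Set
  Fractional p = Free p × Contains p

  Empty : Pixel → Set
  Empty p = Free p × ¬ Contains p

  MaximallyEmpty : Pixel → Set
  MaximallyEmpty p = Empty p × (p ≡ [] ⊎ (∀ a c → p ≡ child a c → ¬ Empty a))

  Open : Pixel → Set
  Open p = Fractional p × (Σ Quadrant λ c → MaximallyEmpty (child p c))

  Compact : Set
  Compact = ∀ p q → layer p ≡ layer q → Open p → Open q → p ≡ q

-- Z-order between pixels neither of which is a descendant of the other:
-- at the lowest common ancestor a, the child containing p precedes the
-- child containing q.
_<z_ : Pixel → Pixel → Set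
p <z q = Σ Pixel λ a → Σ Quadrant λ c₁ → Σ Quadrant λ c₂ →
         Σ Pixel λ s → Σ Pixel λ t →
         (p ≡ a ++ (c₁ ∷ s)) × (q ≡ a ++ (c₂ ∷ t)) × (c₁ <ᶠ c₂)

Invariant : Config → Set
Invariant T = ∀ p q → layer p ≡ layer q → Empty T p → Occupied T q → ¬ (p <z q)

module Submission where

-- Suppose p and q are two distinct open pixels of the same
-- layer.  Same-layer pixels are comparable in z-order, so say p <z q.
-- Since p is open it has an empty child p·c; since q is open it is
-- fractional, hence (being free, thus not occupied) it contains an
-- occupied proper descendant r = q·d·u.  Descendants of empty pixels are
-- empty, so the descendant e = p·c·0…0 of p·c on the layer of r is empty,
-- and extending both sides preserves the z-order, so e <z r: an empty
-- pixel preceding an occupied pixel of the same layer, which the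
-- invariant forbids.

open import Defs
open import Data.Nat using (suc; _+_)
open import Data.Nat.Properties using (suc-injective)
open import Data.Fin using (zero)
open import Data.Fin.Properties using (<-cmp)
open import Data.List using (List; []; _∷_; _++_; [_]; length; replicate)
open import Data.List.Properties
  using (∷-injective; ++-assoc; ++-identityʳ; length-++; length-replicate)
open import Data.Sum using (_⊎_; inj₁; inj₂)
open import Data.Product using (Σ; _,_; proj₁)
open import Data.Empty using (⊥-elim)
open import Relation.Nullary using (¬_)
open import Relation.Binary using (tri<; tri≈; tri>)
open import Relation.Binary.PropositionalEquality
  using (_≡_; refl; sym; trans; cong; cong₂; subst; module ≡-Reasoning)

-- Two prefixes of the same list are comparable: one extends the other.
-- (Needed because an ancestor of a descendant of p is comparable with p.)
prefix-comparable : ∀ {A : Set} (a x p y : List A) → a ++ x ≡ p ++ y →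
  (Σ (List A) λ w → a ++ w ≡ p) ⊎ (Σ (List A) λ w → p ++ w ≡ a)
prefix-comparable []      x p       y e = inj₁ (p , refl)
prefix-comparable (c ∷ a) x []      y e = inj₂ (c ∷ a , refl)
prefix-comparable (c ∷ a) x (d ∷ p) y e with ∷-injective e
... | refl , e′ with prefix-comparable a x p y e′
...   | inj₁ (w , h) = inj₁ (w , cong (c ∷_) h)
...   | inj₂ (w , h) = inj₂ (w , cong (c ∷_) h)

<z-cons : ∀ x {p q} → p <z q → (x ∷ p) <z (x ∷ q)
<z-cons x (a , c₁ , c₂ , s , t , refl , refl , c₁<c₂) =
  x ∷ a , c₁ , c₂ , s , t , refl , refl , c₁<c₂

<z-extend : ∀ {p q} s t → p <z q → (p ++ s) <z (q ++ t)
<z-extend s t (a , c₁ , c₂ , s₀ , t₀ , refl , refl , c₁<c₂) =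
  a , c₁ , c₂ , s₀ ++ s , t₀ ++ t ,
  ++-assoc a (c₁ ∷ s₀) s , ++-assoc a (c₂ ∷ t₀) t , c₁<c₂

<z-trichotomy : ∀ p q → layer p ≡ layer q → p ≡ q ⊎ (p <z q ⊎ q <z p)
<z-trichotomy []      []      _ = inj₁ refl
<z-trichotomy (x ∷ p) (y ∷ q) e with <-cmp x y
... | tri< x<y _ _ = inj₂ (inj₁ ([] , x , y , p , q , refl , refl , x<y))
... | tri> _ _ y<x = inj₂ (inj₂ ([] , y , x , q , p , refl , refl , y<x))
... | tri≈ _ refl _ with <z-trichotomy p q (suc-injective e)
...   | inj₁ refl        = inj₁ refl
...   | inj₂ (inj₁ p<q) = inj₂ (inj₁ (<z-cons x p<q))
...   | inj₂ (inj₂ q<p) = inj₂ (inj₂ (<z-cons x q<p))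

module _ (T : Config) where

  -- Every descendant of an empty pixel is empty: it contains no square
  -- (its squares would lie in p), and it is neither occupied nor blocked,
  -- since an occupied ancestor would be comparable with p.
  empty-descendant : ∀ p s → Empty T p → Empty T (p ++ s)
  empty-descendant p s ((p∉ , p-unblocked) , p-void) =
    (ps∉ , ps-unblocked) , ps-void
    where
    ps-void : ¬ Contains T (p ++ s)
    ps-void (q , q∈ , u , ps++u≡q) =
      p-void (q , q∈ , s ++ u , trans (sym (++-assoc p s u)) ps++u≡q)

    ps∉ : ¬ Occupied T (p ++ s)
    ps∉ ps∈ = ps-void (p ++ s , ps∈ , [] , ++-identityʳ (p ++ s))

    ps-unblocked : ¬ Blocked T (p ++ s)
    ps-unblocked (_ , a , a∈ , c , u , a⊏ps) with prefix-comparable a (c ∷ u) p s a⊏ps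
    ... | inj₂ (w , p++w≡a)   = p-void (a , a∈ , w , p++w≡a)
    ... | inj₁ ([] , a++[]≡p) =
      p∉ (subst (Occupied T) (trans (sym (++-identityʳ a)) a++[]≡p) a∈)
    ... | inj₁ (d ∷ w , a⊏p)  = p-unblocked (p∉ , a , a∈ , d , w , a⊏p)

  -- A fractional pixel contains an occupied proper descendant: the square
  -- it contains cannot be assigned to the pixel itself, which is free.
  fractional-witness : ∀ q → Fractional T q →
    Σ Quadrant λ d → Σ Pixel λ u → Occupied T (q ++ (d ∷ u))
  fractional-witness q ((q∉ , _) , r , r∈ , [] , q++[]≡r) =
    ⊥-elim (q∉ (subst (Occupied T) (trans (sym q++[]≡r) (++-identityʳ q)) r∈))
  fractional-witness q (_ , r , r∈ , d ∷ u , refl) = d , u , r∈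

  -- Pad the empty child p·c with zeros
  -- down to the layer of an occupied descendant of q and apply the
  -- invariant there.
  open-not-before-fractional : Invariant T → ∀ p q → layer p ≡ layer q →
    Open T p → Fractional T q → ¬ (p <z q)
  open-not-before-fractional inv p q p≈q (_ , c , (p·c-empty , _)) q-frac p<q
    with fractional-witness q q-frac
  ... | d , u , r∈ = inv e r e≈r e-empty r∈ (<z-extend (c ∷ pad) (d ∷ u) p<q)
    where
    pad : Pixel
    pad = replicate (length u) zero

    e r : Pixel
    e = p ++ (c ∷ pad)
    r = q ++ (d ∷ u)

    e-empty : Empty T e
    e-empty = subst (Empty T) (++-assoc p [ c ] pad)
                    (empty-descendant (child p c) pad p·c-empty)

    e≈r : layer e ≡ layer r
    e≈r = begin
      length (p ++ (c ∷ pad))     ≡⟨ length-++ p ⟩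
      length p + suc (length pad) ≡⟨ cong₂ (λ m n → m + suc n) p≈q (length-replicate (length u)) ⟩
      length q + suc (length u)   ≡⟨ length-++ q ⟨
      length (q ++ (d ∷ u))       ∎
      where open ≡-Reasoning

lemma4 : (T : Config) → Invariant T → Compact T
lemma4 T inv p q p≈q p-open q-open with <z-trichotomy p q p≈q
... | inj₁ p≡q       = p≡q
... | inj₂ (inj₁ p<q) =
  ⊥-elim (open-not-before-fractional T inv p q p≈q p-open (proj₁ q-open) p<q)
... | inj₂ (inj₂ q<p) =
  ⊥-elim (open-not-before-fractional T inv q p (sym p≈q) q-open (proj₁ p-open) q<p)
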